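{- Let $\mathcal{N}$ be a finite directed acyclic network of recurrent components and delayers. Then $\mathcal{N}$ cannot emulate a presink.
   Context: Components are finite abelian processors (finite state space, commuting transition maps $t_i$, output maps $o_i$ with $o_i+o_jt_i=o_j+o_it_j$); recurrent means every state can be reached from every other state by some input. An abelian network is a directed graph with such a processor at each node, outputs feeding inputs, with designated input and output wires; it emulates a processor if it computes the same function. A delayer has states $0,1$: in state $0$ an input letter moves it permanently to state $1$ and nothing is emitted; in state $1$ it emits one letter per letter received, so from state $0$ it computes $x\mapsto\max(x-1,0)$. A presink has states $0,1$: in state $0$ an input letter moves it permanently to state $1$ and one letter is emitted; later inputs are ignored, so from state $0$ it computes $x\mapsto\min(x,1)$. -}

module Defs where

open import Data.Nat using (ℕ; zero; suc; _+_)
open import Data.Fin using (Fin; zero; suc; toℕ; _≟_)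
open import Data.List using (List; []; _∷_; _++_; concatMap; replicate; allFin; partitionSums; length; filter)
open import Data.Product using (Σ; Σ-syntax; ∃; ∃-syntax; _×_; _,_; proj₁; proj₂)
open import Data.Sum using (_⊎_; inj₁; inj₂)
open import Relation.Nullary using (¬_; yes; no)
open import Relation.Binary.PropositionalEquality using (_≡_; refl)
open import Relation.Binary.Construct.Closure.Transitive using (TransClosure)
open import Relation.Binary.Construct.Closure.ReflexiveTransitive using (Star)

record Processor : Set where
  field
    states  : ℕ
    inputs  : ℕ
    outputs : ℕ
    trans   : Fin inputs → Fin states → Fin states
    out     : Fin inputs → Fin states → Fin outputs → ℕ
    comm    : ∀ a b q → trans a (trans b q) ≡ trans b (trans a q)
    abel    : ∀ a b q k → out a q k + out b (trans a q) k ≡ out b q k + out a (trans b q) k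

open Processor public

runWord : (P : Processor) → List (Fin (inputs P)) → Fin (states P) → Fin (states P)
runWord P []      q = q
runWord P (a ∷ w) q = runWord P w (trans P a q)

outWord : (P : Processor) → List (Fin (inputs P)) → Fin (states P) → Fin (outputs P) → ℕ
outWord P []      q k = 0
outWord P (a ∷ w) q k = out P a q k + outWord P w (trans P a q) k

wordOf : ∀ {n} → (Fin n → ℕ) → List (Fin n)
wordOf {n} x = concatMap (λ i → replicate (x i) i) (allFin n)

-- the function ℕ^A → ℕ^B computed by P started in state q
procFn : (P : Processor) → Fin (states P) → (Fin (inputs P) → ℕ) → Fin (outputs P) → ℕ
procFn P q x = outWord P (wordOf x) q

Recurrent : Processor → Set
Recurrent P = ∀ (q q′ : Fin (states P)) → ∃[ w ] runWord P w q ≡ q′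

delayer : Processor
delayer = record
  { states = 2 ; inputs = 1 ; outputs = 1
  ; trans = λ _ _ → suc zero
  ; out = λ _ q _ → toℕ q
  ; comm = λ _ _ _ → refl
  ; abel = λ _ _ _ _ → refl }

presink : Processor
presink = record
  { states = 2 ; inputs = 1 ; outputs = 1
  ; trans = λ _ _ → suc zero
  ; out = λ _ q _ → emit q
  ; comm = λ _ _ _ → refl
  ; abel = λ _ _ _ _ → refl }
  where
  emit : Fin 2 → ℕ
  emit zero    = 1
  emit (suc _) = 0

record Network (ni no : ℕ) : Set₁ where
  field
    size   : ℕ
    node   : Fin size → Processor
  Letter : Set
  Letter = Σ[ v ∈ Fin size ] Fin (inputs (node v))
  -- where an output letter goes: to an input letter of a node, or to a network output wire
  Target : Set
  Target = Letter ⊎ Fin no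
  field
    route   : (v : Fin size) → Fin (outputs (node v)) → Target
    inRoute : Fin ni → Letter

open Network public

Edge : ∀ {ni no} (N : Network ni no) → Fin (size N) → Fin (size N) → Set
Edge N v u = Σ[ k ∈ Fin (outputs (node N v)) ] Σ[ a ∈ Fin (inputs (node N u)) ] route N v k ≡ inj₁ (u , a)

Acyclic : ∀ {ni no} → Network ni no → Set
Acyclic N = ∀ v → ¬ TransClosure (Edge N) v v

NetState : ∀ {ni no} → Network ni no → Set
NetState N = (v : Fin (size N)) → Fin (states (node N v))

update : ∀ {n} {F : Fin n → Set} → ((v : Fin n) → F v) → (v : Fin n) → F v → (w : Fin n) → F w
update s v x w with v ≟ w
... | yes refl = x
... | no _     = s w

record Config {ni no} (N : Network ni no) : Set where
  constructor config
  field
    cstate  : NetState N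
    pending : List (Letter N)
    emitted : List (Fin no)

open Config public

emission : ∀ {ni no} (N : Network ni no) (v : Fin (size N)) →
           Fin (inputs (node N v)) → Fin (states (node N v)) → List (Target N)
emission N v a q = concatMap (λ k → replicate (out (node N v) a q k) (route N v k)) (allFin _)

data Step {ni no} (N : Network ni no) : Config N → Config N → Set where
  step : ∀ s xs ys os (v : Fin (size N)) (a : Fin (inputs (node N v))) →
         Step N (config s (xs ++ (v , a) ∷ ys) os)
                (config (update s v (trans (node N v) a (s v)))
                        (xs ++ ys ++ proj₁ (partitionSums (emission N v a (s v))))
                        (os ++ proj₂ (partitionSums (emission N v a (s v)))))

Halted : ∀ {ni no} {N : Network ni no} → Config N → Set
Halted c = pending c ≡ []

initial : ∀ {ni no} (N : Network ni no) → NetState N → (Fin ni → ℕ) → Config N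
initial N s x = config s (concatMap (λ i → replicate (x i) (inRoute N i)) (allFin _)) []

outCount : ∀ {ni no} {N : Network ni no} → Config N → Fin no → ℕ
outCount c j = length (filter (j ≟_) (emitted c))

Computes : ∀ {ni no} (N : Network ni no) → NetState N → ((Fin ni → ℕ) → Fin no → ℕ) → Set
Computes N s f =
  ∀ x → (Σ[ c ∈ Config N ] Star (Step N) (initial N s x) c × Halted c)
      × (∀ c → Star (Step N) (initial N s x) c → Halted c → ∀ j → outCount c j ≡ f x j)

Emulates : (P : Processor) → Fin (states P) → (N : Network (inputs P) (outputs P)) → NetState N → Set
Emulates P q N s = Computes N s (procFn P q)

-- Call a target (an input letter of a node, or an output wire) reachable if
-- it is the target of an input wire, or the target of output k of a node v
-- whose input letter a is reachable and emits k in some state.  Two facts: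
--
--  * Pumping.  In a recurrent processor, or in a delayer, an output k that a
--    emits in some state grows without bound as more letters a are fed, no
--    matter which other letters are interleaved.  The a-orbit of the start
--    state enters a cycle (pigeonhole, or the delayer's state 1); recurrence
--    and the abelian property show the cycle emits k; and by the abelian
--    property the other letters only add output.
--  * Invariants of executions.  Along every execution, every letter present
--    has a reachable target, and each node's output so far (computed from the
--    word it has processed) has been delivered to its targets.
--
-- On one input letter the presink emits one letter, so the output wire is
-- reachable.  Following the chain of reachability and using that a halted
-- network has processed every delivered letter, enough input letters force
-- at least two output letters, which a presink never emits.

module Submission where

open import Defs
open import Data.Fin using (Fin; zero; suc; toℕ)
import Data.Fin as F
import Data.Fin.Properties as FinP
open import Data.Nat using (ℕ; zero; suc; _+_; _*_; _∸_; _≤_; _<_; z≤n; s≤s)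
open import Data.Nat.Properties
open import Data.Bool using (true; false)
open import Data.List using (List; []; _∷_; _++_; replicate; length; filter; concatMap; allFin; partitionSums)
open import Data.List.Properties using (filter-++; length-++; filter-accept; filter-reject)
open import Data.List.Membership.Propositional using (_∈_)
open import Data.List.Membership.Propositional.Properties using (∈-allFin; ∈-concatMap⁻; ∈-++⁻; ∈-++⁺ˡ; ∈-++⁺ʳ)
open import Data.List.Relation.Unary.Any using (here; there; satisfied)
open import Data.Product using (∃; ∃-syntax; _×_; _,_; proj₁; proj₂)
import Data.Product.Properties as ΣP
open import Data.Sum using (_⊎_; inj₁; inj₂)
import Data.Sum.Properties as ⊎P
open import Relation.Nullary using (¬_; yes; no; does)
open import Relation.Binary.Definitions using (DecidableEquality)
open import Relation.Binary.PropositionalEquality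
  using (_≡_; refl; sym; cong; cong₂; subst; module ≡-Reasoning)
  renaming (trans to ≡-trans)
open import Relation.Binary.Construct.Closure.ReflexiveTransitive using (Star; ε; _◅_)

-- The
-- supply of letters to each target is measured this way; for output wires
-- it is definitionally the 'outCount' of the specification.
module Counting {A : Set} (_≟_ : DecidableEquality A) where

  count : A → List A → ℕ
  count x xs = length (filter (x ≟_) xs)

  count-here : ∀ {x y} ys → x ≡ y → count x (y ∷ ys) ≡ suc (count x ys)
  count-here ys x≡y = cong length (filter-accept (_ ≟_) x≡y)

  count-skip : ∀ {x y} ys → ¬ x ≡ y → count x (y ∷ ys) ≡ count x ys
  count-skip ys x≢y = cong length (filter-reject (_ ≟_) x≢y)

  count-++ : ∀ x xs ys → count x (xs ++ ys) ≡ count x xs + count x ys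
  count-++ x xs ys = begin
    length (filter (x ≟_) (xs ++ ys))                 ≡⟨ cong length (filter-++ (x ≟_) xs ys) ⟩
    length (filter (x ≟_) xs ++ filter (x ≟_) ys)     ≡⟨ length-++ (filter (x ≟_) xs) ⟩
    count x xs + count x ys                           ∎
    where open ≡-Reasoning

  count-replicate : ∀ x n → count x (replicate n x) ≡ n
  count-replicate x zero    = refl
  count-replicate x (suc n) = begin
    count x (x ∷ replicate n x)   ≡⟨ count-here (replicate n x) refl ⟩
    suc (count x (replicate n x)) ≡⟨ cong suc (count-replicate x n) ⟩
    suc n                         ∎
    where open ≡-Reasoning

  count-pos⇒∈ : ∀ x xs → 0 < count x xs → x ∈ xs
  count-pos⇒∈ x (y ∷ ys) pos with x ≟ y
  ... | yes refl = here refl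
  ... | no _     = there (count-pos⇒∈ x ys pos)

  count-concatMap : ∀ {B : Set} x (f : B → List A) {k ks} → k ∈ ks →
                    count x (f k) ≤ count x (concatMap f ks)
  count-concatMap x f {ks = k ∷ ks} (here refl) = begin
    count x (f k)                              ≤⟨ m≤m+n _ _ ⟩
    count x (f k) + count x (concatMap f ks)   ≡⟨ count-++ x (f k) _ ⟨
    count x (f k ++ concatMap f ks)            ∎
    where open ≤-Reasoning
  count-concatMap x f {ks = k′ ∷ ks} (there k∈ks) = begin
    count x (f _)                               ≤⟨ count-concatMap x f k∈ks ⟩
    count x (concatMap f ks)                    ≤⟨ m≤n+m _ _ ⟩
    count x (f k′) + count x (concatMap f ks)   ≡⟨ count-++ x (f k′) _ ⟨
    count x (f k′ ++ concatMap f ks)            ∎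
    where open ≤-Reasoning

∈-replicate⁻ : ∀ {A : Set} {x y : A} n → x ∈ replicate n y → x ≡ y × 0 < n
∈-replicate⁻ (suc n) (here x≡y) = x≡y , s≤s z≤n
∈-replicate⁻ (suc n) (there x∈) = proj₁ (∈-replicate⁻ n x∈) , s≤s z≤n

module Words (P : Processor) where

  State : Set
  State = Fin (states P)

  open Counting (F._≟_ {inputs P}) public using (count)

  runWord-++ : ∀ u v q → runWord P (u ++ v) q ≡ runWord P v (runWord P u q)
  runWord-++ []      v q = refl
  runWord-++ (a ∷ u) v q = runWord-++ u v (trans P a q)

  outWord-++ : ∀ u v q k → outWord P (u ++ v) q k ≡ outWord P u q k + outWord P v (runWord P u q) k
  outWord-++ []      v q k = refl
  outWord-++ (a ∷ u) v q k = begin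
    out P a q k + outWord P (u ++ v) (trans P a q) k
      ≡⟨ cong (out P a q k +_) (outWord-++ u v (trans P a q) k) ⟩
    out P a q k + (outWord P u (trans P a q) k + outWord P v (runWord P u (trans P a q)) k)
      ≡⟨ +-assoc (out P a q k) _ _ ⟨
    outWord P (a ∷ u) q k + outWord P v (runWord P (a ∷ u) q) k ∎
    where open ≡-Reasoning

  trans-runWord : ∀ a w q → trans P a (runWord P w q) ≡ runWord P w (trans P a q)
  trans-runWord a []      q = refl
  trans-runWord a (b ∷ w) q = ≡-trans (trans-runWord a w (trans P b q)) (cong (runWord P w) (comm P a b q))

  outWord-abel₁ : ∀ a w q k → out P a q k + outWord P w (trans P a q) k ≡ outWord P w q k + out P a (runWord P w q) k
  outWord-abel₁ a []      q k = +-identityʳ _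
  outWord-abel₁ a (b ∷ w) q k = begin
    out P a q k + (out P b (trans P a q) k + outWord P w (trans P b (trans P a q)) k)
      ≡⟨ +-assoc (out P a q k) _ _ ⟨
    (out P a q k + out P b (trans P a q) k) + outWord P w (trans P b (trans P a q)) k
      ≡⟨ cong₂ _+_ (abel P a b q k) (cong (λ r → outWord P w r k) (comm P b a q)) ⟩
    (out P b q k + out P a (trans P b q) k) + outWord P w (trans P a (trans P b q)) k
      ≡⟨ +-assoc (out P b q k) _ _ ⟩
    out P b q k + (out P a (trans P b q) k + outWord P w (trans P a (trans P b q)) k)
      ≡⟨ cong (out P b q k +_) (outWord-abel₁ a w (trans P b q) k) ⟩
    out P b q k + (outWord P w (trans P b q) k + out P a (runWord P w (trans P b q)) k)
      ≡⟨ +-assoc (out P b q k) _ _ ⟨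
    outWord P (b ∷ w) q k + out P a (runWord P (b ∷ w) q) k ∎
    where open ≡-Reasoning

  outWord-abel : ∀ u v q k → outWord P u q k + outWord P v (runWord P u q) k ≡ outWord P v q k + outWord P u (runWord P v q) k
  outWord-abel []      v q k = sym (+-identityʳ _)
  outWord-abel (a ∷ u) v q k = begin
    (A + outWord P u qa k) + outWord P v (runWord P u qa) k
      ≡⟨ +-assoc A _ _ ⟩
    A + (outWord P u qa k + outWord P v (runWord P u qa) k)
      ≡⟨ cong (A +_) (outWord-abel u v qa k) ⟩
    A + (outWord P v qa k + outWord P u (runWord P v qa) k)
      ≡⟨ +-assoc A _ _ ⟨
    (A + outWord P v qa k) + outWord P u (runWord P v qa) k
      ≡⟨ cong₂ _+_ (outWord-abel₁ a v q k) (cong (λ r → outWord P u r k) (sym (trans-runWord a v q))) ⟩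
    (outWord P v q k + out P a (runWord P v q) k) + outWord P u (trans P a (runWord P v q)) k
      ≡⟨ +-assoc (outWord P v q k) _ _ ⟩
    outWord P v q k + outWord P (a ∷ u) (runWord P v q) k ∎
    where open ≡-Reasoning
          A = out P a q k
          qa = trans P a q

  replicate-+ : ∀ (a : Fin (inputs P)) m n → replicate (m + n) a ≡ replicate m a ++ replicate n a
  replicate-+ a zero    n = refl
  replicate-+ a (suc m) n = cong (a ∷_) (replicate-+ a m n)

  -- If the word L is a loop at z, its output is the same at every state
  -- reachable from z (abelian property for u and L, then cancel o_u).
  loop-output-invariant : ∀ L z k → runWord P L z ≡ z → ∀ u → outWord P L (runWord P u z) k ≡ outWord P L z k
  loop-output-invariant L z k loop u = +-cancelˡ-≡ (outWord P u z k) _ _ (begin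
    outWord P u z k + outWord P L (runWord P u z) k ≡⟨ outWord-abel u L z k ⟩
    outWord P L z k + outWord P u (runWord P L z) k ≡⟨ cong (λ r → outWord P L z k + outWord P u r k) loop ⟩
    outWord P L z k + outWord P u z k               ≡⟨ +-comm (outWord P L z k) _ ⟩
    outWord P u z k + outWord P L z k               ∎)
    where open ≡-Reasoning

  outWord-around-loop : ∀ a p z k → runWord P (replicate (suc p) a) z ≡ z → ∀ m →
                        outWord P (replicate (m * suc p) a) z k ≡ m * outWord P (replicate (suc p) a) z k
  outWord-around-loop a p z k loop zero    = refl
  outWord-around-loop a p z k loop (suc m) = begin
    outWord P (replicate (suc p + m * suc p) a) z k
      ≡⟨ cong (λ w → outWord P w z k) (replicate-+ a (suc p) (m * suc p)) ⟩
    outWord P (L ++ replicate (m * suc p) a) z k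
      ≡⟨ outWord-++ L _ z k ⟩
    outWord P L z k + outWord P (replicate (m * suc p) a) (runWord P L z) k
      ≡⟨ cong (λ r → outWord P L z k + outWord P (replicate (m * suc p) a) r k) loop ⟩
    outWord P L z k + outWord P (replicate (m * suc p) a) z k
      ≡⟨ cong (outWord P L z k +_) (outWord-around-loop a p z k loop m) ⟩
    outWord P L z k + m * outWord P L z k ∎
    where open ≡-Reasoning
          L = replicate (suc p) a

  outWord-replicate-mono : ∀ a {m n} → m ≤ n → ∀ q k → outWord P (replicate m a) q k ≤ outWord P (replicate n a) q k
  outWord-replicate-mono a z≤n       q k = z≤n
  outWord-replicate-mono a (s≤s m≤n) q k = +-monoʳ-≤ (out P a q k) (outWord-replicate-mono a m≤n (trans P a q) k)

  -- The occurrences of a in w alone produce no more output than all of w: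
  -- by the abelian property a letter j ≠ a can be moved behind the a's,
  -- where it can only add output.
  outWord-count-≤ : ∀ a w q k → outWord P (replicate (count a w) a) q k ≤ outWord P w q k
  outWord-count-≤ a []      q k = z≤n
  outWord-count-≤ a (j ∷ w) q k with a F.≟ j
  ... | yes refl = +-monoʳ-≤ (out P a q k) (outWord-count-≤ a w (trans P a q) k)
  ... | no _     = begin
    outWord P R q k                                   ≤⟨ m≤m+n _ _ ⟩
    outWord P R q k + out P j (runWord P R q) k       ≡⟨ outWord-abel₁ j R q k ⟨
    out P j q k + outWord P R (trans P j q) k         ≤⟨ +-monoʳ-≤ (out P j q k) (outWord-count-≤ a w (trans P j q) k) ⟩
    out P j q k + outWord P w (trans P j q) k         ∎
    where open ≤-Reasoning
          R = replicate (count a w) a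

  Unbounded : Fin (inputs P) → Fin (outputs P) → State → Set
  Unbounded a k q₀ = ∀ m → ∃[ n ] ∀ w → n ≤ count a w → m ≤ outWord P w q₀ k

  record Pump (a : Fin (inputs P)) (k : Fin (outputs P)) (q₀ : State) : Set where
    field
      offset period : ℕ
      cycle : runWord P (replicate (suc period) a) (runWord P (replicate offset a) q₀) ≡ runWord P (replicate offset a) q₀
      gain  : 1 ≤ outWord P (replicate (suc period) a) (runWord P (replicate offset a) q₀) k

  pump⇒unbounded : ∀ {a k q₀} → Pump a k q₀ → Unbounded a k q₀
  pump⇒unbounded {a} {k} {q₀} pump m = n , λ w n≤count → begin
    m                                                          ≡⟨ *-identityʳ m ⟨
    m * 1                                                      ≤⟨ *-monoʳ-≤ m gain ⟩
    m * outWord P (replicate (suc period) a) z k               ≡⟨ outWord-around-loop a period z k cycle m ⟨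
    outWord P (replicate (m * suc period) a) z k               ≤⟨ m≤n+m _ _ ⟩
    outWord P (replicate offset a) q₀ k + outWord P (replicate (m * suc period) a) z k
                                                               ≡⟨ outWord-++ (replicate offset a) _ q₀ k ⟨
    outWord P (replicate offset a ++ replicate (m * suc period) a) q₀ k
                                                               ≡⟨ cong (λ v → outWord P v q₀ k) (replicate-+ a offset _) ⟨
    outWord P (replicate n a) q₀ k                             ≤⟨ outWord-replicate-mono a n≤count q₀ k ⟩
    outWord P (replicate (count a w) a) q₀ k                   ≤⟨ outWord-count-≤ a w q₀ k ⟩
    outWord P w q₀ k                                           ∎
    where open ≤-Reasoning
          open Pump pump
          z = runWord P (replicate offset a) q₀
          n = offset + m * suc period

  -- In a recurrent processor every output that occurs at all can be pumped:
  -- the a-orbit of q₀ eventually cycles (pigeonhole), and by recurrence the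
  -- cycle's output equals its output at a state where a emits k.
  recurrent⇒pump : Recurrent P → ∀ {a k q′} → 0 < out P a q′ k → ∀ q₀ → Pump a k q₀
  recurrent⇒pump recurrent {a} {k} {q′} emits q₀ = record
    { offset = b ; period = p ; cycle = cycle ; gain = gain }
    where
    orbit : ℕ → State
    orbit n = runWord P (replicate n a) q₀
    repeated = FinP.pigeonhole (n<1+n (states P)) (λ i → orbit (toℕ i))
    i = proj₁ repeated
    j = proj₁ (proj₂ repeated)
    b = toℕ i
    p = toℕ j ∸ suc b
    z = orbit b
    L = replicate (suc p) a
    j≡b+p+1 : b + suc p ≡ toℕ j
    j≡b+p+1 = ≡-trans (+-suc b p) (m+[n∸m]≡n (proj₁ (proj₂ (proj₂ repeated))))
    cycle : runWord P L z ≡ z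
    cycle = begin
      runWord P L (orbit b)                   ≡⟨ runWord-++ (replicate b a) L q₀ ⟨
      runWord P (replicate b a ++ L) q₀        ≡⟨ cong (λ w → runWord P w q₀) (replicate-+ a b (suc p)) ⟨
      orbit (b + suc p)                        ≡⟨ cong orbit j≡b+p+1 ⟩
      orbit (toℕ j)                            ≡⟨ proj₂ (proj₂ (proj₂ repeated)) ⟨
      orbit b                                  ∎
      where open ≡-Reasoning
    u = proj₁ (recurrent z q′)
    gain : 1 ≤ outWord P L z k
    gain = begin
      1                                ≤⟨ emits ⟩
      out P a q′ k                     ≤⟨ m≤m+n _ _ ⟩
      outWord P L q′ k                 ≡⟨ cong (λ r → outWord P L r k) (proj₂ (recurrent z q′)) ⟨
      outWord P L (runWord P u z) k    ≡⟨ loop-output-invariant L z k cycle u ⟩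
      outWord P L z k                  ∎
      where open ≤-Reasoning

-- The delayer is pumped by its first letter: afterwards it echoes every letter.
delayer-pump : ∀ {a k} q₀ → Words.Pump delayer a k q₀
delayer-pump q₀ = record { offset = 1 ; period = 0 ; cycle = refl ; gain = s≤s z≤n }

component-unbounded : ∀ P → Recurrent P ⊎ P ≡ delayer → ∀ {a k q′} → 0 < out P a q′ k →
                      ∀ q₀ → Words.Unbounded P a k q₀
component-unbounded P (inj₁ recurrent) emits q₀ = Words.pump⇒unbounded P (Words.recurrent⇒pump P recurrent emits q₀)
component-unbounded P (inj₂ refl)      emits q₀ = Words.pump⇒unbounded delayer (delayer-pump q₀)

module Execution {ins outs} (N : Network ins outs) (s₀ : NetState N) where

  _≟ℓ_ : DecidableEquality (Letter N)
  _≟ℓ_ = ΣP.≡-dec F._≟_ F._≟_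

  _≟t_ : DecidableEquality (Target N)
  _≟t_ = ⊎P.≡-dec _≟ℓ_ F._≟_

  module ℓ = Counting _≟ℓ_
  module t = Counting _≟t_
  module o = Counting (F._≟_ {outs})

  count : ∀ {u} → Fin (inputs (node N u)) → List (Fin (inputs (node N u))) → ℕ
  count {u} = Words.count (node N u)

  count-lefts : ∀ ℓ (E : List (Target N)) → ℓ.count ℓ (proj₁ (partitionSums E)) ≡ t.count (inj₁ ℓ) E
  count-lefts ℓ []           = refl
  count-lefts ℓ (inj₁ x ∷ E) with does (ℓ ≟ℓ x)
  ... | true  = cong suc (count-lefts ℓ E)
  ... | false = count-lefts ℓ E
  count-lefts ℓ (inj₂ _ ∷ E) = count-lefts ℓ E

  count-rights : ∀ j (E : List (Target N)) → o.count j (proj₂ (partitionSums E)) ≡ t.count (inj₂ j) E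
  count-rights j []           = refl
  count-rights j (inj₂ x ∷ E) with does (j F.≟ x)
  ... | true  = cong suc (count-rights j E)
  ... | false = count-rights j E
  count-rights j (inj₁ _ ∷ E) = count-rights j E

  ∈-lefts : ∀ {ℓ} (E : List (Target N)) → ℓ ∈ proj₁ (partitionSums E) → inj₁ ℓ ∈ E
  ∈-lefts (inj₁ _ ∷ E) (here refl) = here refl
  ∈-lefts (inj₁ _ ∷ E) (there ℓ∈) = there (∈-lefts E ℓ∈)
  ∈-lefts (inj₂ _ ∷ E) ℓ∈         = there (∈-lefts E ℓ∈)

  ∈-rights : ∀ {j} (E : List (Target N)) → j ∈ proj₂ (partitionSums E) → inj₂ j ∈ E
  ∈-rights (inj₂ _ ∷ E) (here refl) = here refl
  ∈-rights (inj₂ _ ∷ E) (there j∈) = there (∈-rights E j∈)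
  ∈-rights (inj₁ _ ∷ E) j∈         = there (∈-rights E j∈)

  emission-count : ∀ v a q k → out (node N v) a q k ≤ t.count (route N v k) (emission N v a q)
  emission-count v a q k = begin
    out (node N v) a q k                                                     ≡⟨ t.count-replicate (route N v k) _ ⟨
    t.count (route N v k) (replicate (out (node N v) a q k) (route N v k))  ≤⟨ t.count-concatMap _ _ (∈-allFin k) ⟩
    t.count (route N v k) (emission N v a q)                                 ∎
    where open ≤-Reasoning

  emission-source : ∀ {v a q τ} → τ ∈ emission N v a q → ∃[ k ] τ ≡ route N v k × 0 < out (node N v) a q k
  emission-source {v} {a} {q} τ∈ =
    let k , τ∈k = satisfied (∈-concatMap⁻ (λ k → replicate (out (node N v) a q k) (route N v k)) {xs = allFin _} τ∈)
    in k , ∈-replicate⁻ _ τ∈k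

  data Reach : Target N → Set where
    input : ∀ i → Reach (inj₁ (inRoute N i))
    relay : ∀ {v a q k} → Reach (inj₁ (v , a)) → 0 < out (node N v) a q k → Reach (route N v k)

  record Reachable (c : Config N) : Set where
    field
      pending-reach : ∀ {ℓ} → ℓ ∈ pending c → Reach (inj₁ ℓ)
      emitted-reach : ∀ {j} → j ∈ emitted c → Reach (inj₂ j)

  initial-reachable : ∀ x → Reachable (initial N s₀ x)
  initial-reachable x = record { pending-reach = from-input ; emitted-reach = λ () }
    where
    from-input : ∀ {ℓ} → ℓ ∈ pending (initial N s₀ x) → Reach (inj₁ ℓ)
    from-input ℓ∈ with satisfied (∈-concatMap⁻ (λ i → replicate (x i) (inRoute N i)) {xs = allFin _} ℓ∈)
    ... | i , ℓ∈i with ∈-replicate⁻ (x i) ℓ∈i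
    ...   | refl , _ = input i

  step-reachable : ∀ {c c′} → Step N c c′ → Reachable c → Reachable c′
  step-reachable (step s xs ys os v a) R = record { pending-reach = pending′ ; emitted-reach = emitted′ }
    where
    open Reachable R
    E = emission N v a (s v)
    emitted-from-va : ∀ {τ} → τ ∈ E → Reach τ
    emitted-from-va τ∈ with emission-source τ∈
    ... | k , refl , emits = relay (pending-reach (∈-++⁺ʳ xs (here refl))) emits
    pending′ : ∀ {ℓ} → ℓ ∈ xs ++ ys ++ proj₁ (partitionSums E) → Reach (inj₁ ℓ)
    pending′ ℓ∈ with ∈-++⁻ xs ℓ∈
    ... | inj₁ ℓ∈xs = pending-reach (∈-++⁺ˡ ℓ∈xs)
    ... | inj₂ ℓ∈rest with ∈-++⁻ ys ℓ∈rest
    ...   | inj₁ ℓ∈ys = pending-reach (∈-++⁺ʳ xs (there ℓ∈ys))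
    ...   | inj₂ ℓ∈E  = emitted-from-va (∈-lefts E ℓ∈E)
    emitted′ : ∀ {j} → j ∈ os ++ proj₂ (partitionSums E) → Reach (inj₂ j)
    emitted′ j∈ with ∈-++⁻ os j∈
    ... | inj₁ j∈os = emitted-reach j∈os
    ... | inj₂ j∈E  = emitted-from-va (∈-rights E j∈E)

  run-reachable : ∀ {c c′} → Star (Step N) c c′ → Reachable c → Reachable c′
  run-reachable ε          R = R
  run-reachable (s₁ ◅ run) R = run-reachable run (step-reachable s₁ R)

  -- A history records the word each node has processed so far.
  History : Set
  History = (u : Fin (size N)) → List (Fin (inputs (node N u)))

  -- Letters delivered so far to a target: for an input letter of a node,
  -- those still pending plus those already processed; for an output wire,
  -- those emitted on it.
  supply : Config N → History → Target N → ℕ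
  supply c h (inj₁ (u , b)) = ℓ.count (u , b) (pending c) + count b (h u)
  supply c h (inj₂ j)       = o.count j (emitted c)

  record Tracks (c : Config N) (h : History) : Set where
    field
      state-eq : ∀ u → cstate c u ≡ runWord (node N u) (h u) (s₀ u)
      output-≤ : ∀ u k → outWord (node N u) (h u) (s₀ u) k ≤ supply c h (route N u k)

  count-same-node : ∀ v (b a : Fin (inputs (node N v))) → ℓ.count (v , b) ((v , a) ∷ []) ≡ count b (a ∷ [])
  count-same-node v b a with b F.≟ a
  ... | yes refl = ℓ.count-here {v , b} [] refl
  ... | no b≢a   = ℓ.count-skip {v , b} {v , a} [] (λ { refl → b≢a refl })

  module AfterStep (s : NetState N) (xs ys : List (Letter N)) (os : List (Fin outs))
                   (v : Fin (size N)) (a : Fin (inputs (node N v))) (h : History) where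

    E : List (Target N)
    E = emission N v a (s v)

    c c′ : Config N
    c  = config s (xs ++ (v , a) ∷ ys) os
    c′ = config (update s v (trans (node N v) a (s v)))
                (xs ++ ys ++ proj₁ (partitionSums E))
                (os ++ proj₂ (partitionSums E))

    h′ : History
    h′ = update {F = λ u → List (Fin (inputs (node N u)))} h v (h v ++ a ∷ [])

    history-count : ∀ u b → count b (h′ u) ≡ ℓ.count (u , b) ((v , a) ∷ []) + count b (h u)
    history-count u b with v F.≟ u
    ... | yes refl = begin
      count b (h v ++ a ∷ [])               ≡⟨ Counting.count-++ F._≟_ b (h v) _ ⟩
      count b (h v) + count b (a ∷ [])      ≡⟨ +-comm (count b (h v)) _ ⟩
      count b (a ∷ []) + count b (h v)      ≡⟨ cong (_+ count b (h v)) (count-same-node v b a) ⟨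
      ℓ.count (v , b) ((v , a) ∷ []) + count b (h v) ∎
      where open ≡-Reasoning
    ... | no v≢u = cong (_+ count b (h u)) (sym (ℓ.count-skip {u , b} {v , a} [] (λ e → v≢u (sym (cong proj₁ e)))))

    supply-step : ∀ τ → supply c′ h′ τ ≡ supply c h τ + t.count τ E
    supply-step (inj₂ j) = ≡-trans (o.count-++ j os _) (cong (o.count j os +_) (count-rights j E))
    supply-step (inj₁ (u , b)) = begin
      ℓ.count (u , b) (xs ++ ys ++ proj₁ (partitionSums E)) + count b (h′ u)
        ≡⟨ cong₂ _+_ new-pending (history-count u b) ⟩
      (X + (Y + T)) + (A + W)
        ≡⟨ solve 5 (λ X A Y W T → (X :+ (Y :+ T)) :+ (A :+ W) := ((X :+ (A :+ Y)) :+ W) :+ T) refl X A Y W T ⟩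
      ((X + (A + Y)) + W) + T
        ≡⟨ cong (λ n → n + W + T) old-pending ⟨
      ℓ.count (u , b) (xs ++ (v , a) ∷ ys) + W + T ∎
      where
      open ≡-Reasoning
      open import Data.Nat.Solver using (module +-*-Solver)
      open +-*-Solver
      X = ℓ.count (u , b) xs
      Y = ℓ.count (u , b) ys
      A = ℓ.count (u , b) ((v , a) ∷ [])
      W = count b (h u)
      T = t.count (inj₁ (u , b)) E
      new-pending : ℓ.count (u , b) (xs ++ ys ++ proj₁ (partitionSums E)) ≡ X + (Y + T)
      new-pending = ≡-trans (ℓ.count-++ _ xs _)
        (cong (X +_) (≡-trans (ℓ.count-++ _ ys _) (cong (Y +_) (count-lefts (u , b) E))))
      old-pending : ℓ.count (u , b) (xs ++ (v , a) ∷ ys) ≡ X + (A + Y)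
      old-pending = ≡-trans (ℓ.count-++ _ xs _) (cong (X +_) (ℓ.count-++ _ ((v , a) ∷ []) ys))

    supply-grows : ∀ τ → supply c h τ ≤ supply c′ h′ τ
    supply-grows τ = ≤-trans (m≤m+n _ _) (≤-reflexive (sym (supply-step τ)))

    tracks-step : Tracks c h → Tracks c′ h′
    tracks-step tracks = record { state-eq = state-eq′ ; output-≤ = output-≤′ }
      where
      open Tracks tracks
      state-eq′ : ∀ u → cstate c′ u ≡ runWord (node N u) (h′ u) (s₀ u)
      state-eq′ u with v F.≟ u
      ... | yes refl = ≡-trans (cong (trans (node N v) a) (state-eq v)) (sym (Words.runWord-++ (node N v) (h v) _ (s₀ v)))
      ... | no _     = state-eq u
      output-≤′ : ∀ u k → outWord (node N u) (h′ u) (s₀ u) k ≤ supply c′ h′ (route N u k)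
      output-≤′ u k with v F.≟ u
      ... | no _     = ≤-trans (output-≤ u k) (supply-grows (route N u k))
      ... | yes refl = begin
        outWord (node N v) (h v ++ a ∷ []) (s₀ v) k
          ≡⟨ Words.outWord-++ (node N v) (h v) _ (s₀ v) k ⟩
        outWord (node N v) (h v) (s₀ v) k + (out (node N v) a (runWord (node N v) (h v) (s₀ v)) k + 0)
          ≡⟨ cong (λ r → outWord (node N v) (h v) (s₀ v) k + r) (+-identityʳ _) ⟩
        outWord (node N v) (h v) (s₀ v) k + out (node N v) a (runWord (node N v) (h v) (s₀ v)) k
          ≡⟨ cong (λ q → outWord (node N v) (h v) (s₀ v) k + out (node N v) a q k) (state-eq v) ⟨
        outWord (node N v) (h v) (s₀ v) k + out (node N v) a (s v) k
          ≤⟨ +-mono-≤ (output-≤ v k) (emission-count v a (s v) k) ⟩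
        supply c h (route N v k) + t.count (route N v k) E
          ≡⟨ supply-step (route N v k) ⟨
        supply c′ h′ (route N v k) ∎
        where open ≤-Reasoning

  run-tracks : ∀ {c c′} → Star (Step N) c c′ → ∀ h → Tracks c h →
               ∃[ h′ ] Tracks c′ h′ × (∀ τ → supply c h τ ≤ supply c′ h′ τ)
  run-tracks ε h tracks = h , tracks , λ τ → ≤-refl
  run-tracks (step s xs ys os v a ◅ run) h tracks
    with run-tracks run (AfterStep.h′ s xs ys os v a h) (AfterStep.tracks-step s xs ys os v a h tracks)
  ... | h″ , tracks″ , grows = h″ , tracks″ , λ τ → ≤-trans (AfterStep.supply-grows s xs ys os v a h τ) (grows τ)

  initial-tracks : ∀ x → Tracks (initial N s₀ x) (λ _ → [])
  initial-tracks x = record { state-eq = λ u → refl ; output-≤ = λ u k → z≤n }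

  initial-supply : ∀ x i → x i ≤ supply (initial N s₀ x) (λ _ → []) (inj₁ (inRoute N i))
  initial-supply x i = begin
    x i                                                   ≡⟨ ℓ.count-replicate (inRoute N i) (x i) ⟨
    ℓ.count (inRoute N i) (replicate (x i) (inRoute N i)) ≤⟨ ℓ.count-concatMap _ _ (∈-allFin i) ⟩
    ℓ.count (inRoute N i) (pending (initial N s₀ x))      ≤⟨ m≤m+n _ 0 ⟩
    supply (initial N s₀ x) (λ _ → []) (inj₁ (inRoute N i)) ∎
    where open ≤-Reasoning

  module _ (components : ∀ v → Recurrent (node N v) ⊎ node N v ≡ delayer) where

    -- Every reachable target receives arbitrarily many letters in a halted
    -- configuration, once all input wires have delivered enough letters:
    -- along the chain witnessing reachability, each component's output is
    -- unbounded in the letters it has consumed, and halting means every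
    -- delivered letter has been consumed.
    reach-unbounded : ∀ {τ} → Reach τ → ∀ B → ∃[ M ] ∀ c h → Tracks c h →
                      (∀ i → M ≤ supply c h (inj₁ (inRoute N i))) → Halted c → B ≤ supply c h τ
    reach-unbounded (input i) B = B , λ c h tracks inputs halted → inputs i
    reach-unbounded (relay {v} {a} {q} {k} r emits) B =
      let n , forces = component-unbounded (node N v) (components v) emits (s₀ v) B
          M , delivered = reach-unbounded r n
      in M , λ c h tracks inputs halted →
        let consumed : n ≤ count a (h v)
            consumed = subst (λ ls → n ≤ ℓ.count (v , a) ls + count a (h v)) halted
                             (delivered c h tracks inputs halted)
        in ≤-trans (forces (h v) consumed) (Tracks.output-≤ tracks v k)

    output-unbounded : ∀ {j} → Reach (inj₂ j) → ∀ B → ∃[ M ] ∀ c →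
                       Star (Step N) (initial N s₀ (λ _ → M)) c → Halted c → B ≤ outCount c j
    output-unbounded r B =
      let M , enough = reach-unbounded r B
      in M , λ c run halted →
        let h , tracks , grows = run-tracks run (λ _ → []) (initial-tracks (λ _ → M))
        in enough c h tracks (λ i → ≤-trans (initial-supply (λ _ → M) i) (grows (inj₁ (inRoute N i)))) halted

  emitting-reachable : ∀ {x c j} → Star (Step N) (initial N s₀ x) c → 0 < outCount c j → Reach (inj₂ j)
  emitting-reachable {x} {c} {j} run emits =
    Reachable.emitted-reach (run-reachable run (initial-reachable x)) (o.count-pos⇒∈ j (emitted c) emits)

halted-run : ∀ {ins outs} {N : Network ins outs} {s f} → Computes N s f → ∀ x →
             ∃[ c ] Star (Step N) (initial N s x) c × Halted c × (∀ j → outCount c j ≡ f x j)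
halted-run computes x =
  let (c , run , halted) , exact = computes x
  in c , run , halted , exact c run halted

presink-silent : ∀ (w : List (Fin 1)) → outWord presink w (suc zero) zero ≡ 0
presink-silent []      = refl
presink-silent (_ ∷ w) = presink-silent w

presink-at-most-one : ∀ (w : List (Fin 1)) → outWord presink w zero zero ≤ 1
presink-at-most-one []      = z≤n
presink-at-most-one (_ ∷ w) = s≤s (≤-reflexive (presink-silent w))

proposition7p5 : (N : Network 1 1) → Acyclic N →
    (∀ (v : Fin (size N)) → Recurrent (node N v) ⊎ node N v ≡ delayer) →
    (s : NetState N) → ¬ Emulates presink zero N s
proposition7p5 N _ components s emulates =
  let c₁ , run₁ , _ , exact₁ = halted-run emulates (λ _ → 1)
      -- on one letter the presink fires, so the output wire is reachable ...
      M , floods = output-unbounded components (emitting-reachable {x = λ _ → 1} run₁ (≤-reflexive (sym (exact₁ zero)))) 2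
      -- ... hence on enough letters the network emits twice, which the presink never does
      c , run , halted , exact = halted-run emulates (λ _ → M)
  in 1+n≰n (begin
       2                                           ≤⟨ floods c run halted ⟩
       outCount c zero                             ≡⟨ exact zero ⟩
       procFn presink zero (λ _ → M) zero          ≤⟨ presink-at-most-one (wordOf (λ _ → M)) ⟩
       1                                           ∎)
  where open Execution N s
        open ≤-Reasoning
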